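{- Let $0<\alpha\leq 1$ and $k>0$. Let $G=(V,E)$ be a $(k,\alpha)$-expander on $n$ vertices and let $V_{0}\subseteq V$ be a vertex set of size $|V_{0}|\leq\epsilon n$, where $0<\epsilon\leq\frac{\alpha^{2}k}{8n}$. Then there is a vertex set $U\subseteq V\setminus V_{0}$ of size $|U|\geq\left(1-\frac{3\epsilon}{\alpha}\right)n$ such that the graph $G[U]$ is a $\left(k,\frac{\alpha}{2}\right)$-expander.
   Context: All graphs are finite and simple. For a graph $G=(V,E)$ and $U\subseteq V$, $N_G(U)=\{v\in V\setminus U: v \text{ has a neighbor in } U\}$. For $k>0$ and $\alpha>0$, $G$ is a $(k,\alpha)$-expander if $|N_G(U)|\geq\alpha|U|$ for every $U\subseteq V$ with $|U|\leq k$. $G[U]$ denotes the induced subgraph on $U$. -}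

module Defs where

open import Data.Nat using (ℕ)
open import Data.Bool using (Bool; true; false; _∧_; _∨_; not)
open import Data.Fin using (Fin)
open import Data.Fin.Subset using (Subset; _∈_; ∣_∣; inside)
open import Data.Vec using (tabulate; lookup)
open import Data.Integer using (+_)
open import Data.Rational using (ℚ; _/_; _*_; _≤_)
open import Relation.Binary.PropositionalEquality using (_≡_)
open import Relation.Nullary using (¬_)

record SimpleGraph (n : ℕ) : Set where
  field
    adj    : Fin n → Fin n → Bool
    sym    : ∀ u v → adj u v ≡ adj v u
    irrefl : ∀ v → adj v v ≡ false
open SimpleGraph public

ℕ→ℚ : ℕ → ℚ
ℕ→ℚ m = + m / 1

anyFin : ∀ {n} → (Fin n → Bool) → Bool
anyFin {ℕ.zero} f = false
anyFin {ℕ.suc n} f = f Fin.zero ∨ anyFin (λ i → f (Fin.suc i))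

-- Neighbourhood of W inside the induced subgraph G[S]:
--   N_{G[S]}(W) = { v ∈ S \ W : v has a neighbour in W }
-- (W is intended to be a subset of S.)
nbhdIn : ∀ {n} → SimpleGraph n → Subset n → Subset n → Subset n
nbhdIn G S W = tabulate λ v →
  lookup S v ∧ not (lookup W v) ∧ anyFin (λ w → lookup W w ∧ adj G w v)

IsExpanderOn : ∀ {n} → SimpleGraph n → Subset n → ℚ → ℚ → Set
IsExpanderOn {n} G S k α =
  ∀ (W : Subset n) → W Data.Fin.Subset.⊆ S → ℕ→ℚ ∣ W ∣ ≤ k →
    α * ℕ→ℚ ∣ W ∣ ≤ ℕ→ℚ ∣ nbhdIn G S W ∣

IsExpander : ∀ {n} → SimpleGraph n → ℚ → ℚ → Set
IsExpander G k α = IsExpanderOn G Data.Fin.Subset.⊤ k α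

-- Grow a set R ⊆ V ∖ V₀ of discarded vertices, keeping |R| ≤ k and
-- |N_{G−V₀}(R)| ≤ (α/2)|R|.  While the survivors V ∖ (V₀ ∪ R) contain some W
-- with |W| ≤ k and fewer than (α/2)|W| neighbours among the survivors, add W
-- to R.  Expansion of G gives (α/2)|R| ≤ |V₀| ≤ εn and (α/2)|W| < εn + |R|,
-- and with 8εn ≤ α²k this forces |R ∪ W| < k, so the invariant persists.
-- R grows strictly, so the process stops; the survivors then induce a
-- (k, α/2)-expander, and there are at least n − εn − 2εn/α ≥ (1 − 3ε/α)n of them.
module Submission where

open import Defs
open import Data.Bool using (Bool; true; false; _∧_; not)
open import Data.Bool.Properties using (∧-conicalˡ; ∧-conicalʳ)
open import Data.Empty using (⊥-elim)
open import Data.Fin using (Fin)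
open import Data.Fin.Subset
  using (Subset; _∈_; _∉_; _⊆_; _∪_; _∩_; ∁; ⊤; ⊥; ∣_∣; inside; outside)
open import Data.Fin.Subset.Properties
  using (_∈?_; _⊆?_; anySubset?; p⊆q⇒∣p∣≤∣q∣; p⊆q⇒∁p⊇∁q; p⊆p∪q; q⊆p∪q; x∈p∪q⁺; x∈p∪q⁻; x∈p∩q⁻;
         x∉p⇒x∈∁p; x∈∁p⇒x∉p; ∉⊥; ⊥⊆; ⊆⊤; ⊆-refl; ∣⊥∣≡0; ∣p∣≤n; ∣∁p∣≡n∸∣p∣)
import Data.Integer as ℤ
import Data.Integer.Properties as ℤ
open import Data.Nat as ℕ using (ℕ; zero; suc; _∸_)
import Data.Nat.Properties as ℕ
open import Data.Nat.Coprimality using (1-coprimeTo) renaming (sym to coprime-sym)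
open import Data.Nat.Induction using (<-wellFounded)
open import Data.Product using (Σ; ∃; _×_; _,_; proj₁; proj₂)
open import Data.Rational
  using (ℚ; mkℚ; _/_; 0ℚ; 1ℚ; ½; _≤_; _<_; _+_; _*_; _-_; -_; _÷_; 1/_; *≤*; >-nonZero; positive; nonNegative)
open import Data.Rational.Properties
  using (normalize-coprime; +-assoc; *-zeroʳ; *-identityˡ; *-inverseʳ; *-distribˡ-+;
         +-mono-≤; +-mono-≤-<; +-monoˡ-≤; +-monoʳ-≤; +-monoˡ-<; +-monoʳ-<;
         *-monoˡ-≤-nonNeg; *-monoʳ-≤-nonNeg; *-monoʳ-<-pos; *-cancelˡ-≤-pos; *-cancelˡ-<-nonNeg;
         nonNeg*nonNeg⇒nonNeg; <⇒≤; ≤-trans; <-≤-trans; <-irrefl; _≤?_; _<?_; ≮⇒≥; module ≤-Reasoning)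
open import Data.Rational.Solver using (module +-*-Solver)
open import Data.Sum using (_⊎_; inj₁; inj₂; [_,_]′)
open import Data.Vec using (_∷_; []; lookup)
open import Data.Vec.Properties using (lookup∘tabulate; []=⇒lookup; lookup⇒[]=)
open import Function using (_∘_)
open import Induction.WellFounded using (Acc; acc)
open import Relation.Nullary using (¬_; Dec; yes; no)
open import Relation.Nullary.Decidable using (_×-dec_)
open import Relation.Binary.PropositionalEquality
  using (_≡_; refl; cong; cong₂; subst; subst₂; trans; module ≡-Reasoning)
  renaming (sym to ≡-sym)

ℕ→ℚ≡mkℚ : ∀ m → ℕ→ℚ m ≡ mkℚ (ℤ.+ m) 0 (coprime-sym (1-coprimeTo m))
ℕ→ℚ≡mkℚ m = normalize-coprime (coprime-sym (1-coprimeTo m))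

ℕ→ℚ-+ : ∀ a b → ℕ→ℚ (a ℕ.+ b) ≡ ℕ→ℚ a + ℕ→ℚ b
ℕ→ℚ-+ a b rewrite ℕ→ℚ≡mkℚ a | ℕ→ℚ≡mkℚ b =
  cong (λ i → i / 1) (≡-sym (cong₂ ℤ._+_ (ℤ.*-identityʳ (ℤ.+ a)) (ℤ.*-identityʳ (ℤ.+ b))))

ℕ→ℚ-mono-≤ : ∀ {a b} → a ℕ.≤ b → ℕ→ℚ a ≤ ℕ→ℚ b
ℕ→ℚ-mono-≤ {a} {b} a≤b rewrite ℕ→ℚ≡mkℚ a | ℕ→ℚ≡mkℚ b =
  *≤* (ℤ.*-monoʳ-≤-nonNeg (ℤ.+ 1) (ℤ.+≤+ a≤b))

ℕ→ℚ-nonNeg : ∀ a → 0ℚ ≤ ℕ→ℚ a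
ℕ→ℚ-nonNeg a = ℕ→ℚ-mono-≤ {0} {a} ℕ.z≤n

open +-*-Solver

p+r-r≡p : ∀ p r → (p + r) - r ≡ p
p+r-r≡p = solve 2 (λ p r → (p :+ r) :- r := p) refl

+-cancelʳ-≤ : ∀ r {p q} → p + r ≤ q + r → p ≤ q
+-cancelʳ-≤ r {p} {q} p+r≤q+r = subst₂ _≤_ (p+r-r≡p p r) (p+r-r≡p q r) (+-monoˡ-≤ (- r) p+r≤q+r)

+-cancelʳ-< : ∀ r {p q} → p + r < q + r → p < q
+-cancelʳ-< r {p} {q} p+r<q+r = subst₂ _<_ (p+r-r≡p p r) (p+r-r≡p q r) (+-monoˡ-< (- r) p+r<q+r)

*-halves : ∀ a r → a * r ≡ (a * ½) * r + (a * ½) * r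
*-halves = solve 2 (λ a r → a :* r := (a :* con ½) :* r :+ (a :* con ½) :* r) refl

module _ {α ε N : ℚ} (α>0 : 0ℚ < α) (α≤1 : α ≤ 1ℚ) (εN≥0 : 0ℚ ≤ ε * N) where

  private
    instance
      α-pos = positive α>0
      α-nonNeg = nonNegative (<⇒≤ α>0)
      εN-nonNeg = nonNegative εN≥0
      α*½-nonNeg = nonNeg*nonNeg⇒nonNeg α ½
      α*α*½-nonNeg = nonNeg*nonNeg⇒nonNeg α (α * ½)

    α*εN≤εN : α * (ε * N) ≤ ε * N
    α*εN≤εN = subst (α * (ε * N) ≤_) (*-identityˡ (ε * N)) (*-monoʳ-≤-nonNeg (ε * N) α≤1)

  r+w<k : ∀ {k r w} → ε * (ℕ→ℚ 8 * N) ≤ α * α * k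
    → (α * ½) * r ≤ ε * N → (α * ½) * w < ε * N + r → r + w < k
  r+w<k {k} {r} {w} 8εN≤α²k r-small w-small = *-cancelˡ-<-nonNeg (α * (α * ½)) (begin-strict
    (α * (α * ½)) * (r + w)                          ≡⟨ split α r w ⟩
    α * ((α * ½) * r) + α * ((α * ½) * w)            <⟨ +-mono-≤-< (*-monoˡ-≤-nonNeg α r-small) (*-monoʳ-<-pos α w-small) ⟩
    α * (ε * N) + α * (ε * N + r)                    ≡⟨ regroup α ε N r ⟩
    (α * (ε * N) + α * (ε * N)) + ((α * ½) * r + (α * ½) * r)
      ≤⟨ +-mono-≤ (+-mono-≤ α*εN≤εN α*εN≤εN) (+-mono-≤ r-small r-small) ⟩
    (ε * N + ε * N) + (ε * N + ε * N)                ≡⟨ four ε N ⟩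
    ½ * (ε * (ℕ→ℚ 8 * N))                            ≤⟨ *-monoˡ-≤-nonNeg ½ 8εN≤α²k ⟩
    ½ * (α * α * k)                                  ≡⟨ halve α k ⟩
    (α * (α * ½)) * k                                ∎)
    where
    open ≤-Reasoning
    split : ∀ a r w → (a * (a * ½)) * (r + w) ≡ a * ((a * ½) * r) + a * ((a * ½) * w)
    split = solve 3 (λ a r w → (a :* (a :* con ½)) :* (r :+ w)
                             := a :* ((a :* con ½) :* r) :+ a :* ((a :* con ½) :* w)) refl
    regroup : ∀ a ε N r → a * (ε * N) + a * (ε * N + r)
                        ≡ (a * (ε * N) + a * (ε * N)) + ((a * ½) * r + (a * ½) * r)
    regroup = solve 4 (λ a ε N r → a :* (ε :* N) :+ a :* (ε :* N :+ r)
                                 := (a :* (ε :* N) :+ a :* (ε :* N)) :+ ((a :* con ½) :* r :+ (a :* con ½) :* r)) refl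
    four : ∀ ε N → (ε * N + ε * N) + (ε * N + ε * N) ≡ ½ * (ε * (ℕ→ℚ 8 * N))
    four = solve 2 (λ ε N → (ε :* N :+ ε :* N) :+ (ε :* N :+ ε :* N)
                          := con ½ :* (ε :* (con (ℕ→ℚ 8) :* N))) refl
    halve : ∀ a k → ½ * (a * a * k) ≡ (a * (a * ½)) * k
    halve = solve 2 (λ a k → con ½ :* (a :* a :* k) := (a :* (a :* con ½)) :* k) refl

  [1-3ε/α]N≤u : ∀ {u v r} → N ≤ (u + v) + r → v ≤ ε * N → (α * ½) * r ≤ ε * N
    → (1ℚ - (ℕ→ℚ 3 * ε ÷ α) {{>-nonZero α>0}}) * N ≤ u
  [1-3ε/α]N≤u {u} {v} {r} N≤u+v+r v-small r-small = *-cancelˡ-≤-pos α (begin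
    α * ((1ℚ - ℕ→ℚ 3 * ε * 1/ α) * N)                 ≡⟨ scale α ε N (1/ α) ⟩
    α * N - (ℕ→ℚ 3 * (ε * N)) * (α * 1/ α)            ≡⟨ cong (λ z → α * N - (ℕ→ℚ 3 * (ε * N)) * z) (*-inverseʳ α) ⟩
    α * N - (ℕ→ℚ 3 * (ε * N)) * 1ℚ                    ≤⟨ +-monoˡ-≤ (- ((ℕ→ℚ 3 * (ε * N)) * 1ℚ)) (*-monoˡ-≤-nonNeg α N≤u+v+r) ⟩
    α * ((u + v) + r) - (ℕ→ℚ 3 * (ε * N)) * 1ℚ        ≡⟨ expand α u v r ε N ⟩
    α * u + ((α * v + (α * ½) * r + (α * ½) * r) - ℕ→ℚ 3 * (ε * N))
      ≤⟨ +-monoʳ-≤ (α * u) (+-monoˡ-≤ (- (ℕ→ℚ 3 * (ε * N)))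
           (+-mono-≤ (+-mono-≤ (≤-trans (*-monoˡ-≤-nonNeg α v-small) α*εN≤εN) r-small) r-small)) ⟩
    α * u + ((ε * N + ε * N + ε * N) - ℕ→ℚ 3 * (ε * N)) ≡⟨ three α u ε N ⟩
    α * u                                              ∎)
    where
    open ≤-Reasoning
    instance _ = >-nonZero α>0
    scale : ∀ a ε N ι → a * ((1ℚ - ℕ→ℚ 3 * ε * ι) * N) ≡ a * N - (ℕ→ℚ 3 * (ε * N)) * (a * ι)
    scale = solve 4 (λ a ε N ι → a :* ((con 1ℚ :- con (ℕ→ℚ 3) :* ε :* ι) :* N)
                               := a :* N :- (con (ℕ→ℚ 3) :* (ε :* N)) :* (a :* ι)) refl
    expand : ∀ a u v r ε N → a * ((u + v) + r) - (ℕ→ℚ 3 * (ε * N)) * 1ℚ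
                             ≡ a * u + ((a * v + (a * ½) * r + (a * ½) * r) - ℕ→ℚ 3 * (ε * N))
    expand = solve 6 (λ a u v r ε N → a :* ((u :+ v) :+ r) :- (con (ℕ→ℚ 3) :* (ε :* N)) :* con 1ℚ
      := a :* u :+ ((a :* v :+ (a :* con ½) :* r :+ (a :* con ½) :* r) :- con (ℕ→ℚ 3) :* (ε :* N))) refl
    three : ∀ a u ε N → a * u + ((ε * N + ε * N + ε * N) - ℕ→ℚ 3 * (ε * N)) ≡ a * u
    three = solve 4 (λ a u ε N → a :* u :+ ((ε :* N :+ ε :* N :+ ε :* N) :- con (ℕ→ℚ 3) :* (ε :* N))
                               := a :* u) refl

∣p∪q∣+∣p∩q∣≡∣p∣+∣q∣ : ∀ {n} (p q : Subset n) → ∣ p ∪ q ∣ ℕ.+ ∣ p ∩ q ∣ ≡ ∣ p ∣ ℕ.+ ∣ q ∣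
∣p∪q∣+∣p∩q∣≡∣p∣+∣q∣ [] [] = refl
∣p∪q∣+∣p∩q∣≡∣p∣+∣q∣ (inside ∷ p) (inside ∷ q) = cong suc (begin
  ∣ p ∪ q ∣ ℕ.+ suc ∣ p ∩ q ∣ ≡⟨ ℕ.+-suc _ _ ⟩
  suc (∣ p ∪ q ∣ ℕ.+ ∣ p ∩ q ∣) ≡⟨ cong suc (∣p∪q∣+∣p∩q∣≡∣p∣+∣q∣ p q) ⟩
  suc (∣ p ∣ ℕ.+ ∣ q ∣) ≡⟨ ℕ.+-suc _ _ ⟨
  ∣ p ∣ ℕ.+ suc ∣ q ∣ ∎)
  where open ≡-Reasoning
∣p∪q∣+∣p∩q∣≡∣p∣+∣q∣ (inside ∷ p) (outside ∷ q) = cong suc (∣p∪q∣+∣p∩q∣≡∣p∣+∣q∣ p q)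
∣p∪q∣+∣p∩q∣≡∣p∣+∣q∣ (outside ∷ p) (inside ∷ q) =
  trans (cong suc (∣p∪q∣+∣p∩q∣≡∣p∣+∣q∣ p q)) (≡-sym (ℕ.+-suc _ _))
∣p∪q∣+∣p∩q∣≡∣p∣+∣q∣ (outside ∷ p) (outside ∷ q) = ∣p∪q∣+∣p∩q∣≡∣p∣+∣q∣ p q

∣p∪q∣≤∣p∣+∣q∣ : ∀ {n} (p q : Subset n) → ∣ p ∪ q ∣ ℕ.≤ ∣ p ∣ ℕ.+ ∣ q ∣
∣p∪q∣≤∣p∣+∣q∣ p q = subst (∣ p ∪ q ∣ ℕ.≤_) (∣p∪q∣+∣p∩q∣≡∣p∣+∣q∣ p q) (ℕ.m≤m+n _ _)

q⊆∁p⇒∣p∪q∣≡∣p∣+∣q∣ : ∀ {n} (p q : Subset n) → q ⊆ ∁ p → ∣ p ∪ q ∣ ≡ ∣ p ∣ ℕ.+ ∣ q ∣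
q⊆∁p⇒∣p∪q∣≡∣p∣+∣q∣ {n} p q q⊆∁p = begin
  ∣ p ∪ q ∣               ≡⟨ ℕ.+-identityʳ _ ⟨
  ∣ p ∪ q ∣ ℕ.+ 0         ≡⟨ cong (∣ p ∪ q ∣ ℕ.+_) ∣p∩q∣≡0 ⟨
  ∣ p ∪ q ∣ ℕ.+ ∣ p ∩ q ∣ ≡⟨ ∣p∪q∣+∣p∩q∣≡∣p∣+∣q∣ p q ⟩
  ∣ p ∣ ℕ.+ ∣ q ∣         ∎
  where
  open ≡-Reasoning
  p∩q⊆⊥ : p ∩ q ⊆ ⊥
  p∩q⊆⊥ x∈p∩q with x∈p∩q⁻ p q x∈p∩q
  ... | x∈p , x∈q = ⊥-elim (x∈∁p⇒x∉p (q⊆∁p x∈q) x∈p)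
  ∣p∩q∣≡0 : ∣ p ∩ q ∣ ≡ 0
  ∣p∩q∣≡0 = ℕ.n≤0⇒n≡0 (subst (∣ p ∩ q ∣ ℕ.≤_) (∣⊥∣≡0 n) (p⊆q⇒∣p∣≤∣q∣ p∩q⊆⊥))

∣∁p∣+∣p∣≡n : ∀ {n} (p : Subset n) → ∣ ∁ p ∣ ℕ.+ ∣ p ∣ ≡ n
∣∁p∣+∣p∣≡n p = trans (cong (ℕ._+ ∣ p ∣) (∣∁p∣≡n∸∣p∣ p)) (ℕ.m∸n+n≡m (∣p∣≤n p))

p⊆q∪r⇒∣p∣≤∣q∣+∣r∣ : ∀ {n} {p : Subset n} (q r : Subset n) → p ⊆ q ∪ r
  → ℕ→ℚ ∣ p ∣ ≤ ℕ→ℚ ∣ q ∣ + ℕ→ℚ ∣ r ∣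
p⊆q∪r⇒∣p∣≤∣q∣+∣r∣ {p = p} q r p⊆q∪r = subst (ℕ→ℚ ∣ p ∣ ≤_) (ℕ→ℚ-+ ∣ q ∣ ∣ r ∣)
  (ℕ→ℚ-mono-≤ (ℕ.≤-trans (p⊆q⇒∣p∣≤∣q∣ p⊆q∪r) (∣p∪q∣≤∣p∣+∣q∣ q r)))

anyFin⁻ : ∀ {n} (f : Fin n → Bool) → anyFin f ≡ true → ∃ λ i → f i ≡ true
anyFin⁻ {suc n} f any-f with f Fin.zero in f0
... | true  = Fin.zero , f0
... | false with anyFin⁻ (λ i → f (Fin.suc i)) any-f
...   | i , fi = Fin.suc i , fi

anyFin⁺ : ∀ {n} (f : Fin n → Bool) i → f i ≡ true → anyFin f ≡ true
anyFin⁺ f Fin.zero    fi rewrite fi = refl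
anyFin⁺ f (Fin.suc i) fi with f Fin.zero
... | true  = refl
... | false = anyFin⁺ (λ i → f (Fin.suc i)) i fi

∉⇒lookup≡false : ∀ {n} {p : Subset n} {x} → x ∉ p → lookup p x ≡ false
∉⇒lookup≡false {p = p} {x} x∉p with lookup p x in px
... | true  = ⊥-elim (x∉p (lookup⇒[]= x p px))
... | false = refl

module _ {n} (G : SimpleGraph n) where

  lookup-nbhdIn : ∀ S W v → lookup (nbhdIn G S W) v
    ≡ (lookup S v ∧ not (lookup W v) ∧ anyFin (λ w → lookup W w ∧ adj G w v))
  lookup-nbhdIn S W v = lookup∘tabulate _ v

  ∈-nbhdIn⁻ : ∀ S W {v} → v ∈ nbhdIn G S W
    → v ∈ S × v ∉ W × ∃ λ w → w ∈ W × adj G w v ≡ true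
  ∈-nbhdIn⁻ S W {v} v∈N =
    lookup⇒[]= v S (∧-conicalˡ _ _ N≡) , v∉W ,
    w , lookup⇒[]= w W (∧-conicalˡ (lookup W w) _ w-edge) , ∧-conicalʳ (lookup W w) _ w-edge
    where
    N≡ : lookup S v ∧ not (lookup W v) ∧ anyFin (λ u → lookup W u ∧ adj G u v) ≡ true
    N≡ = trans (≡-sym (lookup-nbhdIn S W v)) ([]=⇒lookup v∈N)
    ¬W∧E≡ : not (lookup W v) ∧ anyFin (λ u → lookup W u ∧ adj G u v) ≡ true
    ¬W∧E≡ = ∧-conicalʳ (lookup S v) _ N≡
    v∉W : v ∉ W
    v∉W v∈W with subst (λ b → not b ≡ true) ([]=⇒lookup v∈W) (∧-conicalˡ _ _ ¬W∧E≡)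
    ... | ()
    edge : ∃ λ u → (lookup W u ∧ adj G u v) ≡ true
    edge = anyFin⁻ _ (∧-conicalʳ (not (lookup W v)) _ ¬W∧E≡)
    w = proj₁ edge
    w-edge = proj₂ edge

  ∈-nbhdIn⁺ : ∀ {S W v w} → v ∈ S → v ∉ W → w ∈ W → adj G w v ≡ true → v ∈ nbhdIn G S W
  ∈-nbhdIn⁺ {S} {W} {v} {w} v∈S v∉W w∈W w~v = lookup⇒[]= v (nbhdIn G S W) (begin
    lookup (nbhdIn G S W) v ≡⟨ lookup-nbhdIn S W v ⟩
    lookup S v ∧ not (lookup W v) ∧ anyFin (λ u → lookup W u ∧ adj G u v)
      ≡⟨ cong₂ _∧_ ([]=⇒lookup v∈S) (cong₂ _∧_ (cong not (∉⇒lookup≡false v∉W))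
                                              (anyFin⁺ _ w (cong₂ _∧_ ([]=⇒lookup w∈W) w~v))) ⟩
    true ∎)
    where open ≡-Reasoning

  nbhdIn-⊥ : ∀ S → nbhdIn G S ⊥ ⊆ ⊥
  nbhdIn-⊥ S v∈N with ∈-nbhdIn⁻ S ⊥ v∈N
  ... | _ , _ , _ , w∈⊥ , _ = ⊥-elim (∉⊥ w∈⊥)

  nbhdIn⊤-⊆ : ∀ X W → nbhdIn G ⊤ W ⊆ X ∪ nbhdIn G (∁ X) W
  nbhdIn⊤-⊆ X W {v} v∈N with ∈-nbhdIn⁻ ⊤ W v∈N
  ... | _ , v∉W , w , w∈W , w~v with v ∈? X
  ...   | yes v∈X = x∈p∪q⁺ (inj₁ v∈X)
  ...   | no  v∉X = x∈p∪q⁺ (inj₂ (∈-nbhdIn⁺ (x∉p⇒x∈∁p v∉X) v∉W w∈W w~v))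

  nbhdIn-∪-⊆ : ∀ X R W → nbhdIn G (∁ X) (R ∪ W) ⊆ nbhdIn G (∁ X) R ∪ nbhdIn G (∁ (X ∪ R)) W
  nbhdIn-∪-⊆ X R W {v} v∈N with ∈-nbhdIn⁻ (∁ X) (R ∪ W) v∈N
  ... | v∈∁X , v∉R∪W , w , w∈R∪W , w~v with x∈p∪q⁻ R W w∈R∪W
  ...   | inj₁ w∈R = x∈p∪q⁺ (inj₁ (∈-nbhdIn⁺ v∈∁X v∉R w∈R w~v))
    where v∉R = λ v∈R → v∉R∪W (p⊆p∪q W v∈R)
  ...   | inj₂ w∈W = x∈p∪q⁺ (inj₂ (∈-nbhdIn⁺ v∈∁[X∪R] v∉W w∈W w~v))
    where
    v∉W = λ v∈W → v∉R∪W (q⊆p∪q R W v∈W)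
    v∉X∪R : v ∉ X ∪ R
    v∉X∪R v∈X∪R with x∈p∪q⁻ X R v∈X∪R
    ... | inj₁ v∈X = x∈∁p⇒x∉p v∈∁X v∈X
    ... | inj₂ v∈R = v∉R∪W (p⊆p∪q W v∈R)
    v∈∁[X∪R] = x∉p⇒x∈∁p v∉X∪R

module _ {n ℓ} {P Q : Subset n → Set ℓ} where

  saturate : (∀ {R} → P R → Q R ⊎ ∃ λ R′ → P R′ × ∣ R ∣ ℕ.< ∣ R′ ∣)
    → ∀ {R} → P R → ∃ λ R → P R × Q R
  saturate step {R} pR = go pR (<-wellFounded (n ∸ ∣ R ∣))
    where
    go : ∀ {R} → P R → Acc ℕ._<_ (n ∸ ∣ R ∣) → ∃ λ R → P R × Q R
    go {R} pR (acc rs) with step pR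
    ... | inj₁ qR                   = R , pR , qR
    ... | inj₂ (R′ , pR′ , ∣R∣<∣R′∣) = go pR′ (rs (ℕ.∸-monoʳ-< ∣R∣<∣R′∣ (∣p∣≤n R′)))

module Pruning {n} (G : SimpleGraph n) {k α ε : ℚ} (α>0 : 0ℚ < α) (α≤1 : α ≤ 1ℚ)
  (expander : IsExpander G k α) (V₀ : Subset n) (V₀-small : ℕ→ℚ ∣ V₀ ∣ ≤ ε * ℕ→ℚ n)
  (8εn≤α²k : ε * (ℕ→ℚ 8 * ℕ→ℚ n) ≤ α * α * k) where

  open ≤-Reasoning

  Survivors : Subset n → Subset n
  Survivors R = ∁ (V₀ ∪ R)

  Sparse : Subset n → Set
  Sparse R = R ⊆ ∁ V₀ × ℕ→ℚ ∣ R ∣ ≤ k × ℕ→ℚ ∣ nbhdIn G (∁ V₀) R ∣ ≤ (α * ½) * ℕ→ℚ ∣ R ∣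

  Violator : Subset n → Subset n → Set
  Violator R W = W ⊆ Survivors R × ℕ→ℚ ∣ W ∣ ≤ k
               × ℕ→ℚ ∣ nbhdIn G (Survivors R) W ∣ < (α * ½) * ℕ→ℚ ∣ W ∣

  violator? : ∀ R W → Dec (Violator R W)
  violator? R W = W ⊆? Survivors R ×-dec ℕ→ℚ ∣ W ∣ ≤? k ×-dec _ <? _

  εn≥0 : 0ℚ ≤ ε * ℕ→ℚ n
  εn≥0 = ≤-trans (ℕ→ℚ-nonNeg ∣ V₀ ∣) V₀-small

  survivors⊆∁V₀ : ∀ R → Survivors R ⊆ ∁ V₀
  survivors⊆∁V₀ R = p⊆q⇒∁p⊇∁q (p⊆p∪q R)

  sparse-⊥ : 0ℚ ≤ k → Sparse ⊥
  sparse-⊥ k≥0 = ⊥⊆ , subst (λ m → ℕ→ℚ m ≤ k) (≡-sym (∣⊥∣≡0 n)) k≥0 , (begin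
    ℕ→ℚ ∣ N∅ ∣              ≤⟨ ℕ→ℚ-mono-≤ {∣ N∅ ∣} {0} ∣N∅∣≤0 ⟩
    0ℚ                      ≡⟨ *-zeroʳ (α * ½) ⟨
    (α * ½) * 0ℚ            ≡⟨ cong (λ m → (α * ½) * ℕ→ℚ m) (∣⊥∣≡0 n) ⟨
    (α * ½) * ℕ→ℚ ∣ ⊥ {n} ∣ ∎)
    where
    N∅ = nbhdIn G (∁ V₀) ⊥
    ∣N∅∣≤0 : ∣ N∅ ∣ ℕ.≤ 0
    ∣N∅∣≤0 = subst (∣ N∅ ∣ ℕ.≤_) (∣⊥∣≡0 n) (p⊆q⇒∣p∣≤∣q∣ (nbhdIn-⊥ G (∁ V₀)))

  sparse-small : ∀ {R} → Sparse R → (α * ½) * ℕ→ℚ ∣ R ∣ ≤ ε * ℕ→ℚ n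
  sparse-small {R} (_ , R≤k , R-sparse) = +-cancelʳ-≤ ((α * ½) * r) (begin
    (α * ½) * r + (α * ½) * r            ≡⟨ *-halves α r ⟨
    α * r                                ≤⟨ expander R ⊆⊤ R≤k ⟩
    ℕ→ℚ ∣ nbhdIn G ⊤ R ∣                 ≤⟨ p⊆q∪r⇒∣p∣≤∣q∣+∣r∣ V₀ _ (nbhdIn⊤-⊆ G V₀ R) ⟩
    ℕ→ℚ ∣ V₀ ∣ + ℕ→ℚ ∣ nbhdIn G (∁ V₀) R ∣ ≤⟨ +-mono-≤ V₀-small R-sparse ⟩
    ε * ℕ→ℚ n + (α * ½) * r              ∎)
    where r = ℕ→ℚ ∣ R ∣

  violator-small : ∀ {R W} → Violator R W → (α * ½) * ℕ→ℚ ∣ W ∣ < ε * ℕ→ℚ n + ℕ→ℚ ∣ R ∣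
  violator-small {R} {W} (_ , W≤k , W-violates) = +-cancelʳ-< ((α * ½) * w) (begin-strict
    (α * ½) * w + (α * ½) * w              ≡⟨ *-halves α w ⟨
    α * w                                  ≤⟨ expander W ⊆⊤ W≤k ⟩
    ℕ→ℚ ∣ nbhdIn G ⊤ W ∣                   ≤⟨ p⊆q∪r⇒∣p∣≤∣q∣+∣r∣ (V₀ ∪ R) _ (nbhdIn⊤-⊆ G (V₀ ∪ R) W) ⟩
    ℕ→ℚ ∣ V₀ ∪ R ∣ + y                     ≤⟨ +-monoˡ-≤ y (p⊆q∪r⇒∣p∣≤∣q∣+∣r∣ V₀ R ⊆-refl) ⟩
    (ℕ→ℚ ∣ V₀ ∣ + ℕ→ℚ ∣ R ∣) + y           ≤⟨ +-monoˡ-≤ y (+-monoˡ-≤ (ℕ→ℚ ∣ R ∣) V₀-small) ⟩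
    (ε * ℕ→ℚ n + ℕ→ℚ ∣ R ∣) + y            <⟨ +-monoʳ-< (ε * ℕ→ℚ n + ℕ→ℚ ∣ R ∣) W-violates ⟩
    (ε * ℕ→ℚ n + ℕ→ℚ ∣ R ∣) + (α * ½) * w ∎)
    where
    w = ℕ→ℚ ∣ W ∣
    y = ℕ→ℚ ∣ nbhdIn G (Survivors R) W ∣

  violator-nonempty : ∀ {R W} → Violator R W → 0 ℕ.< ∣ W ∣
  violator-nonempty {R} {W} (_ , _ , W-violates) with ∣ W ∣
  ... | zero  = ⊥-elim (<-irrefl refl
    (<-≤-trans (subst (_ <_) (*-zeroʳ (α * ½)) W-violates) (ℕ→ℚ-nonNeg ∣ nbhdIn G (Survivors R) W ∣)))
  ... | suc _ = ℕ.s≤s ℕ.z≤n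

  extend : ∀ {R W} → Sparse R → Violator R W → Sparse (R ∪ W) × ∣ R ∣ ℕ.< ∣ R ∪ W ∣
  extend {R} {W} R-sparse@(R⊆∁V₀ , _ , R-few-nbrs) W-violator@(W⊆survivors , _ , W-violates) =
    (R∪W⊆∁V₀ , R∪W≤k , R∪W-few-nbrs) , ∣R∣<∣R∪W∣
    where
    r = ℕ→ℚ ∣ R ∣
    w = ℕ→ℚ ∣ W ∣
    W⊆∁R : W ⊆ ∁ R
    W⊆∁R = p⊆q⇒∁p⊇∁q (q⊆p∪q V₀ R) ∘ W⊆survivors
    ∣R∪W∣≡ : ∣ R ∪ W ∣ ≡ ∣ R ∣ ℕ.+ ∣ W ∣
    ∣R∪W∣≡ = q⊆∁p⇒∣p∪q∣≡∣p∣+∣q∣ R W W⊆∁R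
    r+w≡ : ℕ→ℚ ∣ R ∪ W ∣ ≡ r + w
    r+w≡ = trans (cong ℕ→ℚ ∣R∪W∣≡) (ℕ→ℚ-+ ∣ R ∣ ∣ W ∣)
    R∪W⊆∁V₀ : R ∪ W ⊆ ∁ V₀
    R∪W⊆∁V₀ x∈R∪W = [ R⊆∁V₀ , survivors⊆∁V₀ R ∘ W⊆survivors ]′ (x∈p∪q⁻ R W x∈R∪W)
    R∪W≤k : ℕ→ℚ ∣ R ∪ W ∣ ≤ k
    R∪W≤k = subst (_≤ k) (≡-sym r+w≡)
      (<⇒≤ (r+w<k {ε = ε} α>0 α≤1 εn≥0 8εn≤α²k (sparse-small R-sparse) (violator-small W-violator)))
    R∪W-few-nbrs : ℕ→ℚ ∣ nbhdIn G (∁ V₀) (R ∪ W) ∣ ≤ (α * ½) * ℕ→ℚ ∣ R ∪ W ∣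
    R∪W-few-nbrs = begin
      ℕ→ℚ ∣ nbhdIn G (∁ V₀) (R ∪ W) ∣
        ≤⟨ p⊆q∪r⇒∣p∣≤∣q∣+∣r∣ (nbhdIn G (∁ V₀) R) _ (nbhdIn-∪-⊆ G V₀ R W) ⟩
      ℕ→ℚ ∣ nbhdIn G (∁ V₀) R ∣ + ℕ→ℚ ∣ nbhdIn G (Survivors R) W ∣
        ≤⟨ +-mono-≤ R-few-nbrs (<⇒≤ W-violates) ⟩
      (α * ½) * r + (α * ½) * w  ≡⟨ *-distribˡ-+ (α * ½) r w ⟨
      (α * ½) * (r + w)          ≡⟨ cong ((α * ½) *_) r+w≡ ⟨
      (α * ½) * ℕ→ℚ ∣ R ∪ W ∣    ∎
    ∣R∣<∣R∪W∣ : ∣ R ∣ ℕ.< ∣ R ∪ W ∣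
    ∣R∣<∣R∪W∣ = subst (∣ R ∣ ℕ.<_) (≡-sym ∣R∪W∣≡) (ℕ.m<m+n ∣ R ∣ (violator-nonempty W-violator))

  no-violator⇒expander : ∀ {R} → (∀ W → ¬ Violator R W) → IsExpanderOn G (Survivors R) k (α * ½)
  no-violator⇒expander none W W⊆survivors W≤k = ≮⇒≥ (λ lt → none W (W⊆survivors , W≤k , lt))

  prune-step : ∀ {R} → Sparse R
    → IsExpanderOn G (Survivors R) k (α * ½) ⊎ ∃ λ R′ → Sparse R′ × ∣ R ∣ ℕ.< ∣ R′ ∣
  prune-step {R} R-sparse with anySubset? (violator? R)
  ... | yes (W , W-violator) = inj₂ (R ∪ W , extend R-sparse W-violator)
  ... | no  no-violator      = inj₁ (no-violator⇒expander (λ W W-violator → no-violator (W , W-violator)))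

  survivors-large : ∀ {R} → Sparse R
    → (1ℚ - (ℕ→ℚ 3 * ε ÷ α) {{>-nonZero α>0}}) * ℕ→ℚ n ≤ ℕ→ℚ ∣ Survivors R ∣
  survivors-large {R} R-sparse = [1-3ε/α]N≤u {ε = ε} α>0 α≤1 εn≥0 n≤u+v+r V₀-small (sparse-small R-sparse)
    where
    n≤u+v+r : ℕ→ℚ n ≤ (ℕ→ℚ ∣ Survivors R ∣ + ℕ→ℚ ∣ V₀ ∣) + ℕ→ℚ ∣ R ∣
    n≤u+v+r = begin
      ℕ→ℚ n                                       ≡⟨ cong ℕ→ℚ (∣∁p∣+∣p∣≡n (V₀ ∪ R)) ⟨
      ℕ→ℚ (∣ Survivors R ∣ ℕ.+ ∣ V₀ ∪ R ∣)         ≡⟨ ℕ→ℚ-+ ∣ Survivors R ∣ ∣ V₀ ∪ R ∣ ⟩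
      ℕ→ℚ ∣ Survivors R ∣ + ℕ→ℚ ∣ V₀ ∪ R ∣         ≤⟨ +-monoʳ-≤ (ℕ→ℚ ∣ Survivors R ∣) (p⊆q∪r⇒∣p∣≤∣q∣+∣r∣ V₀ R ⊆-refl) ⟩
      ℕ→ℚ ∣ Survivors R ∣ + (ℕ→ℚ ∣ V₀ ∣ + ℕ→ℚ ∣ R ∣) ≡⟨ +-assoc (ℕ→ℚ ∣ Survivors R ∣) (ℕ→ℚ ∣ V₀ ∣) (ℕ→ℚ ∣ R ∣) ⟨
      (ℕ→ℚ ∣ Survivors R ∣ + ℕ→ℚ ∣ V₀ ∣) + ℕ→ℚ ∣ R ∣ ∎

lemma2p2 : (n : ℕ) (G : SimpleGraph n) (k α ε : ℚ)
    → (α>0 : 0ℚ < α) → α ≤ 1ℚ → 0ℚ < k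
    → IsExpander G k α
    → (V₀ : Subset n) → ℕ→ℚ ∣ V₀ ∣ ≤ ε * ℕ→ℚ n
    → 0ℚ < ε → ε * (ℕ→ℚ 8 * ℕ→ℚ n) ≤ α * α * k
    → Σ (Subset n) λ U →
        U ⊆ ∁ V₀
        × ((1ℚ - (ℕ→ℚ 3 * ε ÷ α) {{>-nonZero α>0}}) * ℕ→ℚ n ≤ ℕ→ℚ ∣ U ∣)
        × IsExpanderOn G U k (α * ½)
lemma2p2 n G k α ε α>0 α≤1 k>0 expander V₀ V₀-small _ 8εn≤α²k =
  let R , R-sparse , survivors-expand = saturate prune-step (sparse-⊥ (<⇒≤ k>0))
  in Survivors R , survivors⊆∁V₀ R , survivors-large R-sparse , survivors-expand
  where open Pruning G {ε = ε} α>0 α≤1 expander V₀ V₀-small 8εn≤α²k
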